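{- Let $S$ be a cap in $\Sigma=\mathrm{PG}(n,2)$ with the notation of the context. Suppose $2\le r$, that $\widehat C\setminus C=\{c_0\}$ is a single point, that $A(i)+C=B'(i)$ and $B(i)+C=A'(i)$ for all $i$, and that $|A(i)|=|B(i)|=1$ for all $i=1,\dots,2^{n-r-1}$. Fix a projective subspace $L\subseteq K_A$ of projective dimension $n-r-1$ with $L\cap F=\emptyset$, and for $w\in W$ let $(K_A)_w=\{a\in K_A\setminus F: a+w\in L\}$, $A_w=A\cap(K_A)_w$, and let $\overline{A_w}$ be the image of $A_w$ in $\overline\Sigma$. Then $S$ is a complete cap if and only if for every $w\in W$, $$\bigcup_{u\in W}\bigl(\overline{A_u}\oplus\overline{A_{u+w}}\bigr)=\overline{H_\infty},$$ where $\overline{H_\infty}$ is the set of points of $\overline\Sigma$ that are images of points of $H_\infty\setminus F$.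
   Context: Points of $\mathrm{PG}(n,2)$ are the nonzero vectors of $\mathbb{F}_2^{n+1}$; three distinct points $x,y,z$ are collinear iff $x+y=z$. A cap is a set with no three collinear points; complete if not properly contained in another cap. $X\oplus Y=\{x+y:x\in X,y\in Y,x\ne y\}$ (computed in the relevant projective space); for disjoint sets $X+Y=X\oplus Y$. Setting: $H_\infty$ is a codimension-2 subspace of $\Sigma$ disjoint from $S$; $K_A,K_B,K_C$ are the three hyperplanes containing it; $H_X=K_X\setminus H_\infty$; $A=S\cap H_A$, $B=S\cap H_B$, $C=S\cap H_C\neq\emptyset$. $\widetilde F$ is the projective subspace spanned by $C$, of projective dimension $r$; $F=\widetilde F\cap H_\infty$; $W=F\cup\{0\}$ (linear subspace of dimension $r$, whose elements index the classes; $u+w$ is vector addition in $W$); $\widehat C=\widetilde F\setminus F$. $H_A$ is partitioned into the $2^{n-r-1}$ cosets $H_A(i)=a+W$ ($a\in H_A$); $H_B(i)=c+H_A(i)$ for any $c\in\widehat C$. $A(i)=A\cap H_A(i)$, $A'(i)=H_A(i)\setminus A(i)$, $B(i)=B\cap H_B(i)$, $B'(i)=H_B(i)\setminus B(i)$. $\overline\Sigma$ is the projective geometry of the quotient $\mathbb{F}_2^{n+1}/W$; each point $x\notin F$ of $\Sigma$ has an image $\overline x$ (its coset $x+W$), and images of sets are taken pointwise. The sets $\overline{A_w}$, $w\in W$, partition the image $\overline{H_A}$ of $H_A$. -}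

module Defs where

open import Data.Bool using (Bool; true; false; _xor_; _∧_)
open import Data.Nat using (ℕ; suc; zero)
open import Data.Vec using (Vec; []; _∷_; zipWith; replicate; foldr)
open import Data.Vec.Relation.Unary.All using (All)
open import Data.Product using (Σ; ∃; _×_; _,_)
open import Data.Sum using (_⊎_)
open import Relation.Binary.PropositionalEquality using (_≡_; _≢_)
open import Relation.Nullary using (¬_)
open import Function.Bundles using (_⇔_)

-- Vectors of F₂^(n+1); F₂ is Bool with xor as addition and ∧ as multiplication.
V : ℕ → Set
V n = Vec Bool (suc n)

infixl 6 _⊕v_
_⊕v_ : ∀ {m} → Vec Bool m → Vec Bool m → Vec Bool m
_⊕v_ = zipWith _xor_

0v : ∀ {m} → Vec Bool m
0v = replicate _ false

_·_ : ∀ {m} → Vec Bool m → Vec Bool m → Bool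
α · x = foldr _ _xor_ false (zipWith _∧_ α x)

vsum : ∀ {m k} → Vec (Vec Bool m) k → Vec Bool m
vsum [] = 0v
vsum (v ∷ vs) = v ⊕v vsum vs

lincomb : ∀ {m k} → Vec Bool k → Vec (Vec Bool m) k → Vec Bool m
lincomb [] [] = 0v
lincomb (true ∷ cs) (v ∷ vs) = v ⊕v lincomb cs vs
lincomb (false ∷ cs) (v ∷ vs) = lincomb cs vs

LinIndep : ∀ {m k} → Vec (Vec Bool m) k → Set
LinIndep {k = k} b = ∀ (c : Vec Bool k) → lincomb c b ≡ 0v → c ≡ replicate k false

HasDim : ∀ {m} → (Vec Bool m → Set) → ℕ → Set
HasDim {m} P k = Σ (Vec (Vec Bool m) k) λ b →
  LinIndep b × (∀ x → P x ⇔ (∃ λ (c : Vec Bool k) → lincomb c b ≡ x))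

IsSubspace : ∀ {m} → (Vec Bool m → Bool) → Set
IsSubspace L = (L 0v ≡ true) × (∀ x y → L x ≡ true → L y ≡ true → L (x ⊕v y) ≡ true)

-- Sets of points of PG(n,2) are characteristic functions on F₂^(n+1)
-- (finite sets, so Bool-valued membership loses nothing).
_∈_ : ∀ {n} → V n → (V n → Bool) → Set
x ∈ S = S x ≡ true

IsCap : ∀ {n} → (V n → Bool) → Set
IsCap {n} S = (∀ x → x ∈ S → x ≢ 0v)
  × (∀ x y z → x ∈ S → y ∈ S → z ∈ S → x ≢ y → y ≢ z → x ≢ z → x ⊕v y ≢ z)

IsCompleteCap : ∀ {n} → (V n → Bool) → Set
IsCompleteCap {n} S = IsCap S
  × (∀ (T : V n → Bool) → IsCap T → (∀ x → x ∈ S → x ∈ T) → ∀ x → x ∈ T → x ∈ S)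

SumSet : ∀ {n} → (V n → Set) → (V n → Set) → V n → Set
SumSet X Y z = ∃ λ x → ∃ λ y → X x × Y y × x ≢ y × z ≡ x ⊕v y

IsSingleton : ∀ {n} → (V n → Set) → Set
IsSingleton X = ∃ λ x → X x × (∀ y → X y → y ≡ x)

-- The setting.  H_∞ = {x ≠ 0 : α·x = 0, β·x = 0} with α, β linearly
-- independent functionals; K_A = ker α, K_B = ker β, K_C = ker (α+β).
module Setting (n : ℕ) (α β : V n) (S : V n → Bool) where

  IsPoint : V n → Set
  IsPoint x = x ≢ 0v

  Hinf : V n → Set
  Hinf x = IsPoint x × α · x ≡ false × β · x ≡ false

  KA : V n → Set
  KA x = IsPoint x × α · x ≡ false

  -- H_A = K_A ∖ H_∞, etc.
  HA : V n → Set
  HA x = IsPoint x × α · x ≡ false × β · x ≡ true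

  HB : V n → Set
  HB x = IsPoint x × α · x ≡ true × β · x ≡ false

  HC : V n → Set
  HC x = IsPoint x × α · x ≡ true × β · x ≡ true

  A B C : V n → Set
  A x = x ∈ S × HA x
  B x = x ∈ S × HB x
  C x = x ∈ S × HC x

  SpanC : V n → Set
  SpanC x = ∃ λ k → Σ (Vec (V n) k) λ vs → All C vs × vsum vs ≡ x

  Ftil : V n → Set
  Ftil x = SpanC x × IsPoint x

  F : V n → Set
  F x = Ftil x × Hinf x

  W : V n → Set
  W x = F x ⊎ x ≡ 0v

  Chat : V n → Set
  Chat x = Ftil x × ¬ F x

  -- class H_A(i) = a + W, for a ∈ H_A
  HAcls : V n → V n → Set
  HAcls a x = W (x ⊕v a)

  -- H_B(i) = c + H_A(i), with c ∈ Ĉ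
  HBcls : V n → V n → V n → Set
  HBcls c a y = ∃ λ x → HAcls a x × y ≡ c ⊕v x

  Acls A'cls : V n → V n → Set
  Acls a x = A x × HAcls a x
  A'cls a x = HAcls a x × ¬ Acls a x

  Bcls B'cls : V n → V n → V n → Set
  Bcls c a y = B y × HBcls c a y
  B'cls c a y = HBcls c a y × ¬ Bcls c a y

  KAw : (V n → Bool) → V n → V n → Set
  KAw L w x = (KA x × ¬ F x) × (x ⊕v w) ∈ L

  Aw : (V n → Bool) → V n → V n → Set
  Aw L w x = A x × KAw L w x

  -- Points of the quotient geometry Σ̄ = PG(F₂^(n+1)/W) are cosets z + W with
  -- z ∉ W; a set of points of Σ̄ is described by membership of a representative z.
  -- z̄ ∈ ⋃_{u∈W} (Ā_u ⊕ Ā_{u+w}) :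
  UnionSum : (V n → Bool) → V n → V n → Set
  UnionSum L w z = ∃ λ u → W u × ∃ λ x → ∃ λ y →
    Aw L u x × Aw L (u ⊕v w) y × ¬ W (x ⊕v y) × W ((x ⊕v y) ⊕v z)

  HinfBar : V n → Set
  HinfBar z = ∃ λ h → (Hinf h × ¬ F h) × W (h ⊕v z)

-- S is complete iff every point outside S lies on a secant of S.  Translation by c₀ maps A
-- onto B, and the hypotheses A(i) + C = B′(i), B(i) + C = A′(i) put every point of H_A ∪ H_B
-- outside S on a secant.  As C has two points (dim F̃ ≥ 2), every point of F and also c₀ lies
-- on a secant, and a point x ≠ c₀ of H_C ∖ S is a + (a′ + c₀) as soon as x + c₀ = a + a′ with
-- a, a′ ∈ A.  Conversely, a secant through a point h of H∞ ∖ F joins two points of A or two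
-- points of B (C + C ⊆ F̃), so if h ∉ A + A then S ∪ {h} is still a cap.  Hence S is complete
-- iff H∞ ∖ F ⊆ A + A.  Finally K_A = L ⊕ W: if h ≡ w (mod L) with w ∈ W, then h = a + a′ with
-- a ∈ A_u forces a′ ∈ A_{u+w}; conversely a sum x + y over z̄ with x ∈ A_u, y ∈ A_{u+w} differs
-- from z by an element of L ∩ W = 0.  So the union condition is again H∞ ∖ F ⊆ A + A.

module Submission where

open import Algebra.Bundles using (CommutativeMonoid; CommutativeRing)
import Algebra.Properties.CommutativeSemigroup as CommutativeSemigroupProperties
import Algebra.Properties.Monoid as MonoidProperties
open import Algebra.Structures using (IsCommutativeMonoid)
open import Data.Bool using (Bool; true; false; _xor_; _∨_)
import Data.Bool.Properties as Bool
open import Data.Bool.Properties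
  using (xor-assoc; xor-comm; xor-identityˡ; xor-identityʳ; xor-same; ∧-comm; xor-∧-commutativeRing)
open import Data.Empty using (⊥-elim)
open import Data.Fin as Fin using (Fin; combine; punchOut)
open import Data.Fin.Properties
  using (combine-injective; combine-surjective; punchOut-injective; injective⇒≤; any?)
open import Data.Fin.Subset.Properties using (anySubset?)
open import Data.Nat using (ℕ; zero; suc; _+_; _∸_; _^_; _≤_; s≤s; s≤s⁻¹; z≤n)
open import Data.Nat.Properties
  using (_≤?_; ≰⇒>; <⇒≱; ^-monoʳ-<; 1+n≰n; +-suc; m∸n+n≡m; m≤n⇒m≤1+n)
open import Data.Product using (∃; ∃₂; _×_; _,_; proj₁; proj₂)
open import Data.Sum using (_⊎_; inj₁; inj₂)
open import Data.Vec using (Vec; []; _∷_; foldr; replicate; _++_; splitAt)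
open import Data.Vec.Properties
  using (zipWith-assoc; zipWith-comm; zipWith-identityˡ; zipWith-identityʳ; ≡-dec)
open import Data.Vec.Relation.Unary.All using (All; []; _∷_)
open import Function.Base using (_∘_)
open import Function.Bundles using (_⇔_; Equivalence; mk⇔)
open import Function.Definitions using (Injective)
open import Relation.Binary.Bundles using (Setoid)
open import Relation.Binary.PropositionalEquality
  using (_≡_; _≢_; refl; sym; trans; cong; cong₂; subst; isEquivalence; module ≡-Reasoning)
import Relation.Binary.Reasoning.Setoid as SetoidReasoning
open import Relation.Binary.Structures using (IsEquivalence)
open import Relation.Nullary using (¬_; Dec; yes; no; contradiction)
import Relation.Nullary.Decidable as Dec

open import Defs

-- Vectors over F₂

private variable m k p q : ℕ

⊕v-isCommutativeMonoid : IsCommutativeMonoid {A = Vec Bool m} _≡_ _⊕v_ 0v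
⊕v-isCommutativeMonoid = record
  { isMonoid = record
    { isSemigroup = record
      { isMagma = record { isEquivalence = isEquivalence ; ∙-cong = cong₂ _⊕v_ }
      ; assoc = zipWith-assoc xor-assoc }
    ; identity = zipWith-identityˡ xor-identityˡ , zipWith-identityʳ xor-identityʳ }
  ; comm = zipWith-comm xor-comm }

⊕v-commutativeMonoid : ℕ → CommutativeMonoid _ _
⊕v-commutativeMonoid m = record { isCommutativeMonoid = ⊕v-isCommutativeMonoid {m} }

module ⊕v {m : ℕ} where
  open CommutativeMonoid (⊕v-commutativeMonoid m) public
    using (assoc; comm; identityˡ; identityʳ)
  open CommutativeSemigroupProperties (CommutativeMonoid.commutativeSemigroup (⊕v-commutativeMonoid m)) public
  open MonoidProperties (CommutativeMonoid.monoid (⊕v-commutativeMonoid m)) public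
    using (cancelˡ; cancelʳ; cancelᶜ)

module Xor = CommutativeSemigroupProperties (CommutativeRing.+-commutativeSemigroup xor-∧-commutativeRing)

⊕-self : (x : Vec Bool m) → x ⊕v x ≡ 0v
⊕-self []      = refl
⊕-self (b ∷ x) = cong₂ _∷_ (xor-same b) (⊕-self x)

⊕-cancelˡ : (x y : Vec Bool m) → x ⊕v (x ⊕v y) ≡ y
⊕-cancelˡ x = ⊕v.cancelˡ (⊕-self x)

⊕-cancelʳ : (x y : Vec Bool m) → (y ⊕v x) ⊕v x ≡ y
⊕-cancelʳ x = ⊕v.cancelʳ (⊕-self x)

⊕-injectiveʳ : (z : Vec Bool m) {x y : Vec Bool m} → x ⊕v z ≡ y ⊕v z → x ≡ y
⊕-injectiveʳ z {x} {y} eq = begin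
  x              ≡⟨ ⊕-cancelʳ z x ⟨
  (x ⊕v z) ⊕v z  ≡⟨ cong (_⊕v z) eq ⟩
  (y ⊕v z) ⊕v z  ≡⟨ ⊕-cancelʳ z y ⟩
  y              ∎
  where open ≡-Reasoning

⊕-injectiveˡ : (z : Vec Bool m) {x y : Vec Bool m} → z ⊕v x ≡ z ⊕v y → x ≡ y
⊕-injectiveˡ z {x} {y} eq = ⊕-injectiveʳ z (trans (⊕v.comm x z) (trans eq (⊕v.comm z y)))

⊕-cancelˡʳ : (z x : Vec Bool m) → z ⊕v (x ⊕v z) ≡ x
⊕-cancelˡʳ z x = trans (⊕v.comm z (x ⊕v z)) (⊕-cancelʳ z x)

⊕-nonzero⇒≢ : {x y : Vec Bool m} → y ≢ 0v → x ≢ x ⊕v y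
⊕-nonzero⇒≢ {x = x} {y} y≢0 x≡x+y = y≢0 (begin
  y              ≡⟨ ⊕-cancelˡ x y ⟨
  x ⊕v (x ⊕v y)  ≡⟨ cong (x ⊕v_) x≡x+y ⟨
  x ⊕v x         ≡⟨ ⊕-self x ⟩
  0v             ∎)
  where open ≡-Reasoning

⊕-translation-invariant : (x y z : Vec Bool m) → (x ⊕v z) ⊕v (y ⊕v z) ≡ x ⊕v y
⊕-translation-invariant x y z = begin
  (x ⊕v z) ⊕v (y ⊕v z) ≡⟨ ⊕v.interchange x z y z ⟩
  (x ⊕v y) ⊕v (z ⊕v z) ≡⟨ cong ((x ⊕v y) ⊕v_) (⊕-self z) ⟩
  (x ⊕v y) ⊕v 0v       ≡⟨ ⊕v.identityʳ (x ⊕v y) ⟩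
  x ⊕v y               ∎
  where open ≡-Reasoning

⊕≡0⇒≡ : {x y : Vec Bool m} → x ⊕v y ≡ 0v → x ≡ y
⊕≡0⇒≡ {x = x} {y} eq = ⊕-injectiveʳ y (trans eq (sym (⊕-self y)))

_≟v_ : (x y : Vec Bool m) → Dec (x ≡ y)
_≟v_ = ≡-dec Bool._≟_

vsum-++ : (xs : Vec (Vec Bool m) p) (ys : Vec (Vec Bool m) q) → vsum (xs ++ ys) ≡ vsum xs ⊕v vsum ys
vsum-++ []       ys = sym (⊕v.identityˡ _)
vsum-++ (x ∷ xs) ys = trans (cong (x ⊕v_) (vsum-++ xs ys)) (sym (⊕v.assoc x _ _))

All-++ : {P : Vec Bool m → Set} {xs : Vec (Vec Bool m) p} {ys : Vec (Vec Bool m) q} →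
  All P xs → All P ys → All P (xs ++ ys)
All-++ []         Pys = Pys
All-++ (Px ∷ Pxs) Pys = Px ∷ All-++ Pxs Pys

vsum-escape : {P : Vec Bool m → Set} (c : Vec Bool m) {vs : Vec (Vec Bool m) k} → All P vs →
  (∃ λ x → P x × x ≢ c) ⊎ (vsum vs ≡ 0v ⊎ vsum vs ≡ c)
vsum-escape c [] = inj₂ (inj₁ refl)
vsum-escape c {v ∷ _} (Pv ∷ Pvs) with v ≟v c | vsum-escape c Pvs
... | no v≢c   | _                  = inj₁ (v , Pv , v≢c)
... | yes _    | inj₁ escape        = inj₁ escape
... | yes refl | inj₂ (inj₁ rest≡0) = inj₂ (inj₂ (trans (cong (c ⊕v_) rest≡0) (⊕v.identityʳ c)))
... | yes refl | inj₂ (inj₂ rest≡c) = inj₂ (inj₁ (trans (cong (c ⊕v_) rest≡c) (⊕-self c)))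

-- Linear functionals

xor≡false⇒≡ : ∀ a b → a xor b ≡ false → a ≡ b
xor≡false⇒≡ false false _ = refl
xor≡false⇒≡ true  true  _ = refl

·-comm : (φ x : Vec Bool m) → φ · x ≡ x · φ
·-comm φ x = cong (foldr _ _xor_ false) (zipWith-comm ∧-comm φ x)

·-zeroʳ : (φ : Vec Bool m) → φ · 0v ≡ false
·-zeroʳ []          = refl
·-zeroʳ (false ∷ φ) = ·-zeroʳ φ
·-zeroʳ (true ∷ φ)  = ·-zeroʳ φ

·-distribˡ-⊕ : (φ x y : Vec Bool m) → φ · (x ⊕v y) ≡ (φ · x) xor (φ · y)
·-distribˡ-⊕ []          []      []      = refl
·-distribˡ-⊕ (false ∷ φ) (_ ∷ x) (_ ∷ y) = ·-distribˡ-⊕ φ x y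
·-distribˡ-⊕ (true ∷ φ)  (p ∷ x) (q ∷ y) =
  trans (cong ((p xor q) xor_) (·-distribˡ-⊕ φ x y)) (Xor.interchange p q _ _)

·-distribʳ-⊕ : (φ ψ x : Vec Bool m) → (φ ⊕v ψ) · x ≡ (φ · x) xor (ψ · x)
·-distribʳ-⊕ φ ψ x = begin
  (φ ⊕v ψ) · x             ≡⟨ ·-comm (φ ⊕v ψ) x ⟩
  x · (φ ⊕v ψ)             ≡⟨ ·-distribˡ-⊕ x φ ψ ⟩
  (x · φ) xor (x · ψ)      ≡⟨ cong₂ _xor_ (·-comm x φ) (·-comm x ψ) ⟩
  (φ · x) xor (ψ · x)      ∎
  where open ≡-Reasoning

·-linear : ∀ (φ : Vec Bool m) {x y a b} → φ · x ≡ a → φ · y ≡ b → φ · (x ⊕v y) ≡ a xor b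
·-linear φ {x} {y} φx φy = trans (·-distribˡ-⊕ φ x y) (cong₂ _xor_ φx φy)

·-nonzero : (φ x : Vec Bool m) → φ · x ≡ true → x ≢ 0v
·-nonzero φ x φx refl with () ← trans (sym (·-zeroʳ φ)) φx

nonzero⇒witness : {φ : Vec Bool m} → φ ≢ 0v → ∃ λ x → φ · x ≡ true
nonzero⇒witness {φ = []}        φ≢0 = contradiction refl φ≢0
nonzero⇒witness {φ = true ∷ φ}  _   = true ∷ 0v , cong (true xor_) (·-zeroʳ φ)
nonzero⇒witness {φ = false ∷ φ} φ≢0 with x , φx ← nonzero⇒witness (φ≢0 ∘ cong (false ∷_)) = false ∷ x , φx

separating-vector : {α β : Vec Bool m} → β ≢ 0v → α ≢ β → ∃ λ x → α · x ≡ false × β · x ≡ true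
separating-vector {α = α} {β} β≢0 α≢β
  with y , βy ← nonzero⇒witness β≢0
  with t , α⊕β·t ← nonzero⇒witness {φ = α ⊕v β} (α≢β ∘ ⊕≡0⇒≡)
  -- the last argument, (α · t) xor (β · t) ≡ true, makes the two omitted cases absurd
  with α · y in αy | α · t in αt | β · t in βt | trans (sym (·-distribʳ-⊕ α β t)) α⊕β·t
... | false | _     | _     | _  = y , αy , βy
... | true  | false | true  | _  = t , αt , βt
... | true  | true  | false | _  = y ⊕v t , ·-linear α αy αt , ·-linear β βy βt

-- Linear combinations, independence and dimension

lincomb-zeros : (b : Vec (Vec Bool m) k) → lincomb (replicate k false) b ≡ 0v
lincomb-zeros []      = refl
lincomb-zeros (_ ∷ b) = lincomb-zeros b

lincomb-⊕ : (c c′ : Vec Bool k) (b : Vec (Vec Bool m) k) →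
  lincomb (c ⊕v c′) b ≡ lincomb c b ⊕v lincomb c′ b
lincomb-⊕ []          []           []      = sym (⊕-self 0v)
lincomb-⊕ (false ∷ c) (false ∷ c′) (_ ∷ b) = lincomb-⊕ c c′ b
lincomb-⊕ (false ∷ c) (true ∷ c′)  (v ∷ b) =
  trans (cong (v ⊕v_) (lincomb-⊕ c c′ b)) (⊕v.x∙yz≈y∙xz v _ _)
lincomb-⊕ (true ∷ c)  (false ∷ c′) (v ∷ b) =
  trans (cong (v ⊕v_) (lincomb-⊕ c c′ b)) (sym (⊕v.assoc v _ _))
lincomb-⊕ (true ∷ c)  (true ∷ c′)  (v ∷ b) = begin
  lincomb (c ⊕v c′) b                       ≡⟨ lincomb-⊕ c c′ b ⟩
  lincomb c b ⊕v lincomb c′ b               ≡⟨ ⊕v.identityˡ _ ⟨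
  0v ⊕v (lincomb c b ⊕v lincomb c′ b)       ≡⟨ cong (_⊕v _) (⊕-self v) ⟨
  (v ⊕v v) ⊕v (lincomb c b ⊕v lincomb c′ b) ≡⟨ ⊕v.interchange v v _ _ ⟩
  (v ⊕v lincomb c b) ⊕v (v ⊕v lincomb c′ b) ∎
  where open ≡-Reasoning

lincomb-++ : (c : Vec Bool p) (c′ : Vec Bool q) (b : Vec (Vec Bool m) p) (b′ : Vec (Vec Bool m) q) →
  lincomb (c ++ c′) (b ++ b′) ≡ lincomb c b ⊕v lincomb c′ b′
lincomb-++ []          c′ []      b′ = sym (⊕v.identityˡ _)
lincomb-++ (false ∷ c) c′ (_ ∷ b) b′ = lincomb-++ c c′ b b′
lincomb-++ (true ∷ c)  c′ (v ∷ b) b′ =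
  trans (cong (v ⊕v_) (lincomb-++ c c′ b b′)) (sym (⊕v.assoc v _ _))

lincomb-injective : {b : Vec (Vec Bool m) k} → LinIndep b → Injective _≡_ _≡_ (λ c → lincomb c b)
lincomb-injective {b = b} ind {c} {c′} eq = ⊕≡0⇒≡ (ind (c ⊕v c′) (begin
  lincomb (c ⊕v c′) b          ≡⟨ lincomb-⊕ c c′ b ⟩
  lincomb c b ⊕v lincomb c′ b  ≡⟨ cong (_⊕v lincomb c′ b) eq ⟩
  lincomb c′ b ⊕v lincomb c′ b ≡⟨ ⊕-self _ ⟩
  0v                           ∎))
  where open ≡-Reasoning

zeros-++ : (p q : ℕ) → replicate p false ++ replicate q false ≡ replicate (p + q) false
zeros-++ zero    q = refl
zeros-++ (suc p) q = cong (false ∷_) (zeros-++ p q)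

bit : Bool → Fin 2
bit false = Fin.zero
bit true  = Fin.suc Fin.zero

encode : Vec Bool m → Fin (2 ^ m)
encode []      = Fin.zero
encode (b ∷ v) = combine (bit b) (encode v)

encode-injective : Injective _≡_ _≡_ (encode {m})
encode-injective {x = []}    {[]}    _  = refl
encode-injective {x = b ∷ x} {c ∷ y} eq with combine-injective (bit b) (encode x) (bit c) (encode y) eq
encode-injective {x = false ∷ x} {false ∷ y} eq | _ , eq′ = cong (false ∷_) (encode-injective eq′)
encode-injective {x = true ∷ x}  {true ∷ y}  eq | _ , eq′ = cong (true ∷_) (encode-injective eq′)

bit-surjective : (j : Fin 2) → ∃ λ b → bit b ≡ j
bit-surjective Fin.zero            = false , refl
bit-surjective (Fin.suc Fin.zero) = true , refl

encode-surjective : (i : Fin (2 ^ m)) → ∃ λ (v : Vec Bool m) → encode v ≡ i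
encode-surjective {zero}  Fin.zero = [] , refl
encode-surjective {suc m} i
  with j , l , refl ← combine-surjective {2} {2 ^ m} i
  with b , refl ← bit-surjective j
  with v , refl ← encode-surjective {m} l
  = b ∷ v , refl

decode : Fin (2 ^ m) → Vec Bool m
decode {m} i = proj₁ (encode-surjective {m} i)

encode-decode : (i : Fin (2 ^ m)) → encode (decode {m} i) ≡ i
encode-decode {m} i = proj₂ (encode-surjective {m} i)

decode-injective : Injective _≡_ _≡_ (decode {m})
decode-injective {m} {i} {j} eq = begin
  i                     ≡⟨ encode-decode {m} i ⟨
  encode (decode {m} i) ≡⟨ cong encode eq ⟩
  encode (decode {m} j) ≡⟨ encode-decode {m} j ⟩
  j                     ∎
  where open ≡-Reasoning

Fin-injective⇒surjective : ∀ {N} {f : Fin N → Fin N} → Injective _≡_ _≡_ f → ∀ y → ∃ λ x → f x ≡ y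
Fin-injective⇒surjective {suc N} {f} f-inj y with any? (λ x → f x Fin.≟ y)
... | yes hit = hit
... | no miss = contradiction (injective⇒≤ g-inj) 1+n≰n
  where
  g : Fin (suc N) → Fin N
  g x = punchOut {i = y} (miss ∘ (x ,_) ∘ sym)
  g-inj : Injective _≡_ _≡_ g
  g-inj = f-inj ∘ punchOut-injective {i = y} _ _

encode-conjugate-injective : {f : Vec Bool k → Vec Bool m} → Injective _≡_ _≡_ f →
  Injective _≡_ _≡_ (encode ∘ f ∘ decode)
encode-conjugate-injective {k} {m} f-inj = decode-injective {k} ∘ f-inj ∘ encode-injective {m}

injective⇒≤ᵛ : {f : Vec Bool k → Vec Bool m} → Injective _≡_ _≡_ f → k ≤ m
injective⇒≤ᵛ {k} {m} f-inj with k ≤? m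
... | yes k≤m = k≤m
... | no  k≰m = contradiction (injective⇒≤ (encode-conjugate-injective f-inj))
                              (<⇒≱ (^-monoʳ-< 2 (s≤s (s≤s z≤n)) (≰⇒> k≰m)))

injective⇒surjectiveᵛ : {f : Vec Bool m → Vec Bool m} → Injective _≡_ _≡_ f → ∀ y → ∃ λ x → f x ≡ y
injective⇒surjectiveᵛ f-inj y
  with i , eq ← Fin-injective⇒surjective (encode-conjugate-injective f-inj) (encode y)
  = decode i , encode-injective eq

independent⇒≤ : {b : Vec (Vec Bool m) k} → LinIndep b → k ≤ m
independent⇒≤ ind = injective⇒≤ᵛ (lincomb-injective ind)

independent⇒spanning : {b : Vec (Vec Bool m) m} → LinIndep b → ∀ x → ∃ λ c → lincomb c b ≡ x
independent⇒spanning ind = injective⇒surjectiveᵛ (lincomb-injective ind)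

module _ {P Q : Vec Bool m → Set} (dimP : HasDim P p) (dimQ : HasDim Q q)
         (P∩Q≡0 : ∀ {x} → P x → Q x → x ≡ 0v) where

  private
    bP : Vec (Vec Bool m) p
    bP = proj₁ dimP
    bQ : Vec (Vec Bool m) q
    bQ = proj₁ dimQ

    inP : (c : Vec Bool p) → P (lincomb c bP)
    inP c = Equivalence.from (proj₂ (proj₂ dimP) _) (c , refl)

    inQ : (c : Vec Bool q) → Q (lincomb c bQ)
    inQ c = Equivalence.from (proj₂ (proj₂ dimQ) _) (c , refl)

  bases-++-independent : LinIndep (bP ++ bQ)
  bases-++-independent c eq with c₁ , c₂ , refl ← splitAt p c = begin
    c₁ ++ c₂                               ≡⟨ cong₂ _++_ (proj₁ (proj₂ dimP) c₁ y≡0)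
                                                         (proj₁ (proj₂ dimQ) c₂ z≡0) ⟩
    replicate p false ++ replicate q false ≡⟨ zeros-++ p q ⟩
    replicate (p + q) false                ∎
    where
    open ≡-Reasoning
    y≡z : lincomb c₁ bP ≡ lincomb c₂ bQ
    y≡z = ⊕≡0⇒≡ (trans (sym (lincomb-++ c₁ c₂ bP bQ)) eq)
    y≡0 : lincomb c₁ bP ≡ 0v
    y≡0 = P∩Q≡0 (inP c₁) (subst Q (sym y≡z) (inQ c₂))
    z≡0 : lincomb c₂ bQ ≡ 0v
    z≡0 = trans (sym y≡z) y≡0

  complementary-subspaces-span : p + q ≡ m → ∀ x → ∃₂ λ y z → P y × Q z × y ⊕v z ≡ x
  complementary-subspaces-span refl x
    with c , eq ← independent⇒spanning bases-++-independent x
    with c₁ , c₂ , refl ← splitAt p c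
    = lincomb c₁ bP , lincomb c₂ bQ , inP c₁ , inQ c₂ , trans (sym (lincomb-++ c₁ c₂ bP bQ)) eq

dim≥2⇒two-points : {P : Vec Bool m → Set} → HasDim P k → 2 ≤ k →
  ∃₂ λ b₀ b₁ → P b₀ × P b₁ × b₀ ≢ 0v × b₁ ≢ 0v × b₀ ≢ b₁
dim≥2⇒two-points {P = P} (b₀ ∷ b₁ ∷ bs , ind , span) (s≤s (s≤s _)) =
  b₀ , b₁ , in-span u₀ e₀ , in-span u₁ e₁ , b₀≢0 , b₁≢0 , b₀≢b₁
  where
  u₀ u₁ u₀₁ : Vec Bool _
  u₀  = true ∷ false ∷ replicate _ false
  u₁  = false ∷ true ∷ replicate _ false
  u₀₁ = true ∷ true ∷ replicate _ false
  in-span : ∀ c {x} → lincomb c (b₀ ∷ b₁ ∷ bs) ≡ x → P x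
  in-span c eq = Equivalence.from (span _) (c , eq)
  e₀ : lincomb u₀ (b₀ ∷ b₁ ∷ bs) ≡ b₀
  e₀ = trans (cong (b₀ ⊕v_) (lincomb-zeros bs)) (⊕v.identityʳ b₀)
  e₁ : lincomb u₁ (b₀ ∷ b₁ ∷ bs) ≡ b₁
  e₁ = trans (cong (b₁ ⊕v_) (lincomb-zeros bs)) (⊕v.identityʳ b₁)
  b₀≢0 : b₀ ≢ 0v
  b₀≢0 b₀≡0 with () ← ind u₀ (trans e₀ b₀≡0)
  b₁≢0 : b₁ ≢ 0v
  b₁≢0 b₁≡0 with () ← ind u₁ (trans e₁ b₁≡0)
  b₀≢b₁ : b₀ ≢ b₁
  b₀≢b₁ refl with () ← ind u₀₁ (trans (cong (b₀ ⊕v_) e₁) (⊕-self b₀))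

HasDim⇒decidable : {P : Vec Bool m → Set} → HasDim P k → ∀ x → Dec (P x)
HasDim⇒decidable (b , _ , span) x =
  Dec.map′ (Equivalence.from (span x)) (Equivalence.to (span x)) (anySubset? (λ c → lincomb c b ≟v x))

-- Subspaces and their cosets

record IsLinearSubspace (U : Vec Bool m → Set) : Set where
  field
    0v∈ : U 0v
    ⊕-closed : ∀ {x y} → U x → U y → U (x ⊕v y)

module Coset {U : Vec Bool m → Set} (U-linear : IsLinearSubspace U) where
  open IsLinearSubspace U-linear

  infix 4 _≈_
  _≈_ : Vec Bool m → Vec Bool m → Set
  x ≈ y = U (x ⊕v y)

  ≈-isEquivalence : IsEquivalence _≈_
  ≈-isEquivalence = record
    { refl  = λ {x} → subst U (sym (⊕-self x)) 0v∈
    ; sym   = λ {x} {y} → subst U (⊕v.comm x y)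
    ; trans = λ {x} {y} {z} x≈y y≈z → subst U (⊕v.cancelᶜ (⊕-self y) x z) (⊕-closed x≈y y≈z)
    }

  setoid : Setoid _ _
  setoid = record { isEquivalence = ≈-isEquivalence }

  open IsEquivalence ≈-isEquivalence public using () renaming (refl to ≈-refl; sym to ≈-sym; trans to ≈-trans)

  ⊕-cong : ∀ {x x′ y y′} → x ≈ x′ → y ≈ y′ → x ⊕v y ≈ x′ ⊕v y′
  ⊕-cong {x} {x′} {y} {y′} x≈x′ y≈y′ = subst U (sym (⊕v.interchange x y x′ y′)) (⊕-closed x≈x′ y≈y′)

  ≈0v⇔ : ∀ {x} → x ≈ 0v ⇔ U x
  ≈0v⇔ {x} = mk⇔ (subst U (⊕v.identityʳ x)) (subst U (sym (⊕v.identityʳ x)))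

  ·-cong : ∀ φ {x y} → (∀ {u} → U u → φ · u ≡ false) → x ≈ y → φ · x ≡ φ · y
  ·-cong φ {x} {y} φ[U]≡0 x≈y = xor≡false⇒≡ _ _ (trans (sym (·-distribˡ-⊕ φ x y)) (φ[U]≡0 x≈y))

  module ≈-Reasoning = SetoidReasoning setoid

-- Caps and secants

Secant : ∀ {n} → (V n → Bool) → V n → Set
Secant S = SumSet (_∈ S) (_∈ S)

SumSet-mono : ∀ {n} {X X′ Y Y′ : V n → Set} → (∀ {x} → X x → X′ x) → (∀ {y} → Y y → Y′ y) →
  ∀ {z} → SumSet X Y z → SumSet X′ Y′ z
SumSet-mono X⊆X′ Y⊆Y′ (x , y , Xx , Yy , x≢y , z≡x+y) = x , y , X⊆X′ Xx , Y⊆Y′ Yy , x≢y , z≡x+y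

module _ {n} {S : V n → Bool} where

  secant-through : ∀ {s z} → s ∈ S → (s ⊕v z) ∈ S → z ≢ 0v → Secant S z
  secant-through {s} {z} s∈S s+z∈S z≢0 =
    s , s ⊕v z , s∈S , s+z∈S , ⊕-nonzero⇒≢ z≢0 , sym (⊕-cancelˡ s z)

  insert : V n → V n → Bool
  insert z x = S x ∨ Dec.does (x ≟v z)

  module _ {z : V n} where

    ∈-insert⁺ : ∀ {x} → x ∈ S → x ∈ insert z
    ∈-insert⁺ x∈S = cong (_∨ _) x∈S

    z∈insert : z ∈ insert z
    z∈insert with z ≟v z
    ... | yes _  = Bool.∨-zeroʳ (S z)
    ... | no z≢z = contradiction refl z≢z

    ∈-insert⁻ : ∀ {x} → x ∈ insert z → x ∈ S ⊎ x ≡ z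
    ∈-insert⁻ {x} x∈ with S x | x ≟v z
    ... | true  | _      = inj₁ refl
    ... | false | yes eq = inj₂ eq

    insert-cap : IsCap S → z ≢ 0v → (∀ s → s ∈ S → ¬ (s ⊕v z) ∈ S) → IsCap (insert z)
    insert-cap (S-points , S-no-lines) z≢0 no-secant = points , no-lines
      where
      points : ∀ x → x ∈ insert z → x ≢ 0v
      points x x∈ with ∈-insert⁻ x∈
      ... | inj₁ x∈S  = S-points x x∈S
      ... | inj₂ refl = z≢0
      no-lines : ∀ x y w → x ∈ insert z → y ∈ insert z → w ∈ insert z →
                 x ≢ y → y ≢ w → x ≢ w → x ⊕v y ≢ w
      no-lines x y w x∈ y∈ w∈ x≢y y≢w x≢w x+y≡w with ∈-insert⁻ x∈ | ∈-insert⁻ y∈ | ∈-insert⁻ w∈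
      ... | inj₁ x∈S  | inj₁ y∈S  | inj₁ w∈S  = S-no-lines x y w x∈S y∈S w∈S x≢y y≢w x≢w x+y≡w
      ... | inj₁ x∈S  | inj₁ y∈S  | inj₂ refl =
        no-secant x x∈S (subst (_∈ S) (trans (sym (⊕-cancelˡ x y)) (cong (x ⊕v_) x+y≡w)) y∈S)
      ... | inj₁ x∈S  | inj₂ refl | inj₁ w∈S  = no-secant x x∈S (subst (_∈ S) (sym x+y≡w) w∈S)
      ... | inj₂ refl | inj₁ y∈S  | inj₁ w∈S  =
        no-secant y y∈S (subst (_∈ S) (trans (sym x+y≡w) (⊕v.comm x y)) w∈S)
      ... | inj₂ refl | inj₂ refl | _         = x≢y refl
      ... | inj₂ refl | _         | inj₂ refl = x≢w refl
      ... | _         | inj₂ refl | inj₂ refl = y≢w refl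

  complete⇒secant : IsCompleteCap S → ∀ {z} → z ≢ 0v → ¬ z ∈ S → Secant S z
  complete⇒secant (S-cap , S-maximal) {z} z≢0 z∉S
    with anySubset? (λ s → (S s Bool.≟ true) Dec.×-dec (S (s ⊕v z) Bool.≟ true))
  ... | yes (s , s∈S , s+z∈S) = secant-through s∈S s+z∈S z≢0
  ... | no no-secant = contradiction
        (S-maximal (insert z) (insert-cap S-cap z≢0 (λ s s∈S s+z∈S → no-secant (s , s∈S , s+z∈S)))
                   (λ _ → ∈-insert⁺) z z∈insert)
        z∉S

  secant⇒complete : IsCap S → (∀ {z} → z ≢ 0v → ¬ z ∈ S → Secant S z) → IsCompleteCap S
  secant⇒complete S-cap secants = S-cap , maximal
    where
    maximal : ∀ T → IsCap T → (∀ x → x ∈ S → x ∈ T) → ∀ x → x ∈ T → x ∈ S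
    maximal T (T-points , T-no-lines) S⊆T x x∈T with S x in x∈?S
    ... | true  = refl
    ... | false with s , s′ , s∈S , s′∈S , s≢s′ , x≡s+s′ ← secants (T-points x x∈T) (Bool.not-¬ x∈?S)
      = contradiction (sym x≡s+s′)
          (T-no-lines s s′ x (S⊆T s s∈S) (S⊆T s′ s′∈S) x∈T s≢s′ (differ s′∈S) (differ s∈S))
      where
      differ : ∀ {y} → y ∈ S → y ≢ x
      differ y∈S refl = Bool.not-¬ x∈?S y∈S

-- The configuration of the proposition

module Geometry (n : ℕ) (α β : V n) (S : V n → Bool) where
  open Setting n α β S

  SpanC-linear : IsLinearSubspace SpanC
  SpanC-linear = record
    { 0v∈      = 0 , [] , [] , refl
    ; ⊕-closed = λ where
        (_ , xs , Cxs , refl) (_ , ys , Cys , refl) → _ , xs ++ ys , All-++ Cxs Cys , vsum-++ xs ys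
    }

  open IsLinearSubspace SpanC-linear using (⊕-closed)

  C⊆SpanC : ∀ {x} → C x → SpanC x
  C⊆SpanC {x} Cx = 1 , x ∷ [] , Cx ∷ [] , ⊕v.identityʳ x

  SpanC⇒α≡β : ∀ {x} → SpanC x → α · x ≡ β · x
  SpanC⇒α≡β (_ , _ , Cvs , refl) = vsum-α≡β Cvs
    where
    vsum-α≡β : ∀ {k} {vs : Vec (V n) k} → All C vs → α · vsum vs ≡ β · vsum vs
    vsum-α≡β []                        = trans (·-zeroʳ α) (sym (·-zeroʳ β))
    vsum-α≡β ((_ , _ , αv , βv) ∷ Cvs) =
      trans (·-linear α αv refl) (trans (cong (true xor_) (vsum-α≡β Cvs)) (sym (·-linear β βv refl)))

  SpanC-escape : ∀ c {x} → SpanC x → (∃ λ c′ → C c′ × c′ ≢ c) ⊎ (x ≡ 0v ⊎ x ≡ c)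
  SpanC-escape c (_ , _ , Cvs , refl) = vsum-escape c Cvs

  W-intro : ∀ {x} → SpanC x → α · x ≡ false → W x
  W-intro {x} x∈F̃ αx with x ≟v 0v
  ... | yes x≡0 = inj₂ x≡0
  ... | no  x≢0 = inj₁ ((x∈F̃ , x≢0) , x≢0 , αx , trans (sym (SpanC⇒α≡β x∈F̃)) αx)

  W⇒SpanC : ∀ {x} → W x → SpanC x
  W⇒SpanC (inj₁ ((x∈F̃ , _) , _)) = x∈F̃
  W⇒SpanC (inj₂ refl)             = IsLinearSubspace.0v∈ SpanC-linear

  W⇒α≡false : ∀ {x} → W x → α · x ≡ false
  W⇒α≡false (inj₁ (_ , _ , αx , _)) = αx
  W⇒α≡false (inj₂ refl)             = ·-zeroʳ α

  W⇒β≡false : ∀ {x} → W x → β · x ≡ false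
  W⇒β≡false (inj₁ (_ , _ , _ , βx)) = βx
  W⇒β≡false (inj₂ refl)             = ·-zeroʳ β

  W-linear : IsLinearSubspace W
  W-linear = record
    { 0v∈      = inj₂ refl
    ; ⊕-closed = λ x∈W y∈W → W-intro (⊕-closed (W⇒SpanC x∈W) (W⇒SpanC y∈W))
                                     (·-linear α (W⇒α≡false x∈W) (W⇒α≡false y∈W))
    }

  -- HAcls a x is x ≈W a: the classes H_A(i) are the W-cosets meeting H_A.
  module W≈ = Coset W-linear
  open W≈ using () renaming (_≈_ to _≈W_)

  Chat-intro : ∀ {x} → SpanC x → α · x ≡ true → Chat x
  Chat-intro {x} x∈F̃ αx = (x∈F̃ , ·-nonzero α x αx) , λ (_ , _ , α[x]≡false , _) → Bool.not-¬ α[x]≡false αx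

  Chat⇒α≡true : ∀ {x} → Chat x → α · x ≡ true
  Chat⇒α≡true {x} ((x∈F̃ , x≢0) , x∉F) =
    Bool.¬-not λ αx → x∉F ((x∈F̃ , x≢0) , x≢0 , αx , trans (sym (SpanC⇒α≡β x∈F̃)) αx)

  A⇒KA∖F : ∀ {a} → A a → KA a × ¬ F a
  A⇒KA∖F (_ , a≢0 , αa , βa) = (a≢0 , αa) , λ (_ , _ , _ , β[a]≡false) → Bool.not-¬ β[a]≡false βa

  module Hypotheses
    (S-cap : IsCap S) (β≢0 : β ≢ 0v) (α≢β : α ≢ β)
    (S∩H∞≡∅ : ∀ x → x ∈ S → ¬ Hinf x) (C≢∅ : ∃ C)
    (r : ℕ) (2≤r : 2 ≤ r) (dim-F̃ : HasDim SpanC (suc r))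
    (c₀ : V n) (Ĉ∖C≡c₀ : ∀ x → (Chat x × ¬ C x) ⇔ (x ≡ c₀))
    (class-sums : ∀ a → HA a →
      (∀ z → SumSet (Acls a) C z ⇔ B'cls c₀ a z) × (∀ z → SumSet (Bcls c₀ a) C z ⇔ A'cls a z))
    (|A[i]|≡1 : ∀ a → HA a → IsSingleton (Acls a))
    (L : V n → Bool) (L-subspace : IsSubspace L) (dim-L : HasDim (_∈ L) (n ∸ r))
    (L⊆K_A : ∀ x → x ∈ L → α · x ≡ false) (L∩F≡∅ : ∀ x → x ∈ L → ¬ F x)
    where

    A+C≡B′ : ∀ a → HA a → ∀ z → SumSet (Acls a) C z ⇔ B'cls c₀ a z
    A+C≡B′ a a∈HA = proj₁ (class-sums a a∈HA)

    B+C≡A′ : ∀ a → HA a → ∀ z → SumSet (Bcls c₀ a) C z ⇔ A'cls a z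
    B+C≡A′ a a∈HA = proj₂ (class-sums a a∈HA)

    c₀∈Ĉ : Chat c₀
    c₀∈Ĉ = proj₁ (Equivalence.from (Ĉ∖C≡c₀ c₀) refl)

    c₀∉C : ¬ C c₀
    c₀∉C = proj₂ (Equivalence.from (Ĉ∖C≡c₀ c₀) refl)

    c₀∈F̃ : SpanC c₀
    c₀∈F̃ = proj₁ (proj₁ c₀∈Ĉ)

    α·c₀ : α · c₀ ≡ true
    α·c₀ = Chat⇒α≡true c₀∈Ĉ

    β·c₀ : β · c₀ ≡ true
    β·c₀ = trans (sym (SpanC⇒α≡β c₀∈F̃)) α·c₀

    F̃∖F⊆C∪c₀ : ∀ {x} → SpanC x → α · x ≡ true → x ≢ c₀ → C x
    F̃∖F⊆C∪c₀ {x} x∈F̃ αx x≢c₀ with S x in x∈?S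
    ... | true  = refl , ·-nonzero α x αx , αx , trans (sym (SpanC⇒α≡β x∈F̃)) αx
    ... | false = contradiction
      (Equivalence.to (Ĉ∖C≡c₀ x) (Chat-intro x∈F̃ αx , λ (x∈S , _) → Bool.not-¬ x∈?S x∈S)) x≢c₀

    A-unique : ∀ {a a′} → A a → A a′ → a′ ≈W a → a′ ≡ a
    A-unique {a} {a′} Aa Aa′ a′≈a with _ , _ , unique ← |A[i]|≡1 a (proj₂ Aa) =
      trans (unique a′ (Aa′ , a′≈a)) (sym (unique a (Aa , W≈.≈-refl)))

    A⇒B : ∀ {a} → A a → B (a ⊕v c₀)
    A⇒B {a} Aa@(_ , _ , αa , βa) with S (a ⊕v c₀) in a+c₀∈?S
    ... | true = refl , ·-nonzero α _ α[a+c₀] , α[a+c₀] , ·-linear β βa β·c₀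
      where
      α[a+c₀] : α · (a ⊕v c₀) ≡ true
      α[a+c₀] = ·-linear α αa α·c₀
    ... | false
      with a′ , c , (Aa′ , a′≈a) , Cc , _ , a+c₀≡a′+c ←
             Equivalence.from (A+C≡B′ a (proj₂ Aa) (a ⊕v c₀))
               ((a , W≈.≈-refl , ⊕v.comm a c₀) , λ ((a+c₀∈S , _) , _) → Bool.not-¬ a+c₀∈?S a+c₀∈S)
      = ⊥-elim (c₀∉C (subst C c≡c₀ Cc))
      where
      c≡c₀ : c ≡ c₀
      c≡c₀ = ⊕-injectiveˡ a (trans (cong (_⊕v c) (sym (A-unique Aa Aa′ a′≈a))) (sym a+c₀≡a′+c))

    HB-shift : ∀ {x} → HB x → HA (x ⊕v c₀)
    HB-shift (_ , αx , βx) = ·-nonzero β _ (·-linear β βx β·c₀) , ·-linear α αx α·c₀ , ·-linear β βx β·c₀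

    B⇒A : ∀ {b} → B b → A (b ⊕v c₀)
    B⇒A {b} Bb@(_ , b∈HB@(b≢0 , αb , _))
      with a′ , (Aa′@(_ , _ , αa′ , _) , a′≈a) , _ ← |A[i]|≡1 (b ⊕v c₀) (HB-shift b∈HB)
      with (a′ ⊕v b) ≟v c₀
    ... | yes a′+b≡c₀ =
      subst A (trans (sym (⊕-cancelʳ b a′)) (trans (cong (_⊕v b) a′+b≡c₀) (⊕v.comm c₀ b))) Aa′
    ... | no a′+b≢c₀ = ⊥-elim (proj₂ (Equivalence.to (A+C≡B′ _ (HB-shift b∈HB) b) b∈A+C) (Bb , b∈class))
      where
      b∈class : HBcls c₀ (b ⊕v c₀) b
      b∈class = b ⊕v c₀ , W≈.≈-refl , sym (⊕-cancelˡʳ c₀ b)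
      a′+b∈F̃ : SpanC (a′ ⊕v b)
      a′+b∈F̃ = subst SpanC (trans (⊕v.assoc a′ (b ⊕v c₀) c₀) (cong (a′ ⊕v_) (⊕-cancelʳ c₀ b)))
                 (⊕-closed (W⇒SpanC a′≈a) c₀∈F̃)
      b∈A+C : SumSet (Acls (b ⊕v c₀)) C b
      b∈A+C = a′ , a′ ⊕v b , (Aa′ , a′≈a) , F̃∖F⊆C∪c₀ a′+b∈F̃ (·-linear α αa′ αb) a′+b≢c₀ ,
              ⊕-nonzero⇒≢ b≢0 , sym (⊕-cancelˡ a′ b)

    A≢∅ : ∃ A
    A≢∅ with x , αx , βx ← separating-vector β≢0 α≢β
        with a , (Aa , _) , _ ← |A[i]|≡1 x (·-nonzero β x βx , αx , βx) = a , Aa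

    H∞∖F⊆A+A : Set
    H∞∖F⊆A+A = ∀ {h} → Hinf h → ¬ F h → SumSet A A h

    secant⇒A+A : ∀ {h} → Hinf h → ¬ F h → Secant S h → SumSet A A h
    secant⇒A+A {h} (h≢0 , αh , βh) h∉F (s , s′ , s∈S , s′∈S , s≢s′ , h≡s+s′) =
      by-region (α · s) (β · s) refl refl
      where
      agree : ∀ φ → φ · h ≡ false → φ · s′ ≡ φ · s
      agree φ φh =
        sym (xor≡false⇒≡ _ _ (trans (sym (·-distribˡ-⊕ φ s s′)) (trans (cong (φ ·_) (sym h≡s+s′)) φh)))
      s≢0 : s ≢ 0v
      s≢0 = proj₁ S-cap s s∈S
      s′≢0 : s′ ≢ 0v
      s′≢0 = proj₁ S-cap s′ s′∈S
      by-region : ∀ a b → α · s ≡ a → β · s ≡ b → SumSet A A h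
      by-region false false αs βs = ⊥-elim (S∩H∞≡∅ s s∈S (s≢0 , αs , βs))
      by-region false true  αs βs =
        s , s′ , (s∈S , s≢0 , αs , βs) , (s′∈S , s′≢0 , trans (agree α αh) αs , trans (agree β βh) βs) ,
        s≢s′ , h≡s+s′
      by-region true  false αs βs =
        s ⊕v c₀ , s′ ⊕v c₀ , B⇒A (s∈S , s≢0 , αs , βs) ,
        B⇒A (s′∈S , s′≢0 , trans (agree α αh) αs , trans (agree β βh) βs) ,
        s≢s′ ∘ ⊕-injectiveʳ c₀ , trans h≡s+s′ (sym (⊕-translation-invariant s s′ c₀))
      by-region true  true  αs βs = ⊥-elim (h∉F ((h∈F̃ , h≢0) , h≢0 , αh , βh))
        where
        C-point : ∀ {x} → x ∈ S → α · x ≡ true → β · x ≡ true → SpanC x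
        C-point x∈S αx βx = C⊆SpanC (x∈S , ·-nonzero α _ αx , αx , βx)
        h∈F̃ : SpanC h
        h∈F̃ = subst SpanC (sym h≡s+s′)
                 (⊕-closed (C-point s∈S αs βs) (C-point s′∈S (trans (agree α αh) αs) (trans (agree β βh) βs)))

    complete⇒A+A : IsCompleteCap S → H∞∖F⊆A+A
    complete⇒A+A complete h∈H∞@(h≢0 , _) h∉F =
      secant⇒A+A h∈H∞ h∉F (complete⇒secant complete h≢0 λ h∈S → S∩H∞≡∅ _ h∈S h∈H∞)

    -- The only use of 2 ≤ r; 1 ≤ r would do.
    C-point-other-than : ∀ c → ∃ λ c′ → C c′ × c′ ≢ c
    C-point-other-than c
      with b₀ , b₁ , b₀∈F̃ , b₁∈F̃ , b₀≢0 , b₁≢0 , b₀≢b₁ ← dim≥2⇒two-points dim-F̃ (m≤n⇒m≤1+n 2≤r)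
      with SpanC-escape c b₀∈F̃ | SpanC-escape c b₁∈F̃
    ... | inj₁ escape | _           = escape
    ... | inj₂ _      | inj₁ escape = escape
    ... | inj₂ b₀∈⟨c⟩ | inj₂ b₁∈⟨c⟩ = ⊥-elim (b₀≢b₁ (trans (on-line b₀≢0 b₀∈⟨c⟩) (sym (on-line b₁≢0 b₁∈⟨c⟩))))
      where
      on-line : ∀ {x} → x ≢ 0v → x ≡ 0v ⊎ x ≡ c → x ≡ c
      on-line x≢0 (inj₁ x≡0) = contradiction x≡0 x≢0
      on-line _   (inj₂ x≡c) = x≡c

    F-secant-via : ∀ {x c} → F x → C c → c ⊕v x ≢ c₀ → Secant S x
    F-secant-via ((x∈F̃ , x≢0) , _ , αx , _) Cc@(c∈S , _ , αc , _) c+x≢c₀ =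
      secant-through c∈S (proj₁ (F̃∖F⊆C∪c₀ (⊕-closed (C⊆SpanC Cc) x∈F̃) (·-linear α αc αx) c+x≢c₀)) x≢0

    F⇒secant : ∀ {x} → F x → Secant S x
    F⇒secant {x} x∈F = secant-from (proj₂ C≢∅)
      where
      secant-from : ∀ {c} → C c → Secant S x
      secant-from {c} Cc with c′ , Cc′ , c′≢c ← C-point-other-than c with (c ⊕v x) ≟v c₀
      ... | no  c+x≢c₀ = F-secant-via x∈F Cc c+x≢c₀
      ... | yes c+x≡c₀ = F-secant-via x∈F Cc′ λ c′+x≡c₀ → c′≢c (⊕-injectiveʳ x (trans c′+x≡c₀ (sym c+x≡c₀)))

    HA∖S⇒secant : ∀ {x} → HA x → ¬ x ∈ S → Secant S x
    HA∖S⇒secant {x} x∈HA x∉S = SumSet-mono (proj₁ ∘ proj₁) proj₁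
      (Equivalence.from (B+C≡A′ x x∈HA x) (W≈.≈-refl , x∉S ∘ proj₁ ∘ proj₁))

    HB∖S⇒secant : ∀ {x} → HB x → ¬ x ∈ S → Secant S x
    HB∖S⇒secant {x} x∈HB x∉S = SumSet-mono (proj₁ ∘ proj₁) proj₁
      (Equivalence.from (A+C≡B′ (x ⊕v c₀) (HB-shift x∈HB) x)
        ((x ⊕v c₀ , W≈.≈-refl , sym (⊕-cancelˡʳ c₀ x)) , x∉S ∘ proj₁ ∘ proj₁))

    A+A-shift-secant : ∀ {h} → SumSet A A h → Secant S (h ⊕v c₀)
    A+A-shift-secant (a , a′ , Aa@(a∈S , _ , _ , βa) , Aa′ , _ , h≡a+a′) =
      a , a′ ⊕v c₀ , a∈S , b∈S , a≢b , trans (cong (_⊕v c₀) h≡a+a′) (⊕v.assoc a a′ c₀)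
      where
      b∈S : (a′ ⊕v c₀) ∈ S
      b∈S = proj₁ (A⇒B Aa′)
      a≢b : a ≢ a′ ⊕v c₀
      a≢b a≡b = Bool.not-¬ (proj₂ (proj₂ (proj₂ (A⇒B Aa′)))) (trans (cong (β ·_) (sym a≡b)) βa)

    c₀-secant : Secant S c₀
    c₀-secant with a , Aa ← A≢∅ = secant-through (proj₁ Aa) (proj₁ (A⇒B Aa)) (·-nonzero α c₀ α·c₀)

    HC∖S⇒secant : H∞∖F⊆A+A → ∀ {x} → HC x → ¬ x ∈ S → Secant S x
    HC∖S⇒secant A+A {x} (_ , αx , βx) x∉S with x ≟v c₀
    ... | yes refl  = c₀-secant
    ... | no  x≢c₀ = subst (Secant S) (⊕-cancelʳ c₀ x) (A+A-shift-secant (A+A h∈H∞ h∉F))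
      where
      h∈H∞ : Hinf (x ⊕v c₀)
      h∈H∞ = x≢c₀ ∘ ⊕≡0⇒≡ , ·-linear α αx α·c₀ , ·-linear β βx β·c₀
      h∉F : ¬ F (x ⊕v c₀)
      h∉F ((h∈F̃ , _) , _) =
        x∉S (proj₁ (F̃∖F⊆C∪c₀ (subst SpanC (⊕-cancelʳ c₀ x) (⊕-closed h∈F̃ c₀∈F̃)) αx x≢c₀))

    H∞⇒secant : H∞∖F⊆A+A → ∀ {x} → Hinf x → Secant S x
    H∞⇒secant A+A {x} x∈H∞ with HasDim⇒decidable dim-F̃ x
    ... | yes x∈F̃ = F⇒secant ((x∈F̃ , proj₁ x∈H∞) , x∈H∞)
    ... | no  x∉F̃ = SumSet-mono proj₁ proj₁ (A+A x∈H∞ (x∉F̃ ∘ proj₁ ∘ proj₁))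

    A+A⇒secant : H∞∖F⊆A+A → ∀ {x} → x ≢ 0v → ¬ x ∈ S → Secant S x
    A+A⇒secant A+A {x} x≢0 x∉S with α · x in αx | β · x in βx
    ... | false | false = H∞⇒secant A+A (x≢0 , αx , βx)
    ... | false | true  = HA∖S⇒secant (x≢0 , αx , βx) x∉S
    ... | true  | false = HB∖S⇒secant (x≢0 , αx , βx) x∉S
    ... | true  | true  = HC∖S⇒secant A+A (x≢0 , αx , βx) x∉S

    L-linear : IsLinearSubspace (_∈ L)
    L-linear = record { 0v∈ = proj₁ L-subspace ; ⊕-closed = proj₂ L-subspace _ _ }

    module L≈ = Coset L-linear
    open L≈ using () renaming (_≈_ to _≈L_)

    L∩F̃≡0 : ∀ {x} → x ∈ L → SpanC x → x ≡ 0v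
    L∩F̃≡0 {x} x∈L x∈F̃ with x ≟v 0v
    ... | yes x≡0 = x≡0
    ... | no  x≢0 = ⊥-elim (L∩F≡∅ x x∈L ((x∈F̃ , x≢0) , x≢0 , αx , trans (sym (SpanC⇒α≡β x∈F̃)) αx))
      where
      αx : α · x ≡ false
      αx = L⊆K_A x x∈L

    dim-L+dim-F̃≡n+1 : n ∸ r + suc r ≡ suc n
    dim-L+dim-F̃≡n+1 = trans (+-suc (n ∸ r) r) (cong suc (m∸n+n≡m r≤n))
      where
      r≤n : r ≤ n
      r≤n = s≤s⁻¹ (independent⇒≤ (proj₁ (proj₂ dim-F̃)))

    K_A⊆L+W : ∀ {x} → α · x ≡ false → ∃ λ w → W w × x ≈L w
    K_A⊆L+W {x} αx = split (complementary-subspaces-span dim-L dim-F̃ L∩F̃≡0 dim-L+dim-F̃≡n+1 x)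
      where
      split : (∃₂ λ l s → l ∈ L × SpanC s × l ⊕v s ≡ x) → ∃ λ w → W w × x ≈L w
      split (l , s , l∈L , s∈F̃ , l+s≡x) = s , W-intro s∈F̃ αs , subst (_∈ L) (sym x+s≡l) l∈L
        where
        αs : α · s ≡ false
        αs = trans (sym (·-linear α (L⊆K_A l l∈L) refl)) (trans (cong (α ·_) l+s≡x) αx)
        x+s≡l : x ⊕v s ≡ l
        x+s≡l = trans (cong (_⊕v s) (sym l+s≡x)) (⊕-cancelʳ s l)

    coset-meets-L-translate : ∀ {z w} → α · z ≡ false → W w → ∃ λ h → h ≈W z × h ≈L w
    coset-meets-L-translate {z} {w} αz w∈W with wz , wz∈W , z≈wz ← K_A⊆L+W αz =
      z ⊕v (wz ⊕v w) , h≈z , h≈w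
      where
      h≈z : z ⊕v (wz ⊕v w) ≈W z
      h≈z = begin
        z ⊕v (wz ⊕v w) ≈⟨ W≈.⊕-cong W≈.≈-refl (Equivalence.from W≈.≈0v⇔ wz+w∈W) ⟩
        z ⊕v 0v        ≡⟨ ⊕v.identityʳ z ⟩
        z              ∎
        where
        open W≈.≈-Reasoning
        wz+w∈W : W (wz ⊕v w)
        wz+w∈W = IsLinearSubspace.⊕-closed W-linear wz∈W w∈W
      h≈w : z ⊕v (wz ⊕v w) ≈L w
      h≈w = begin
        z ⊕v (wz ⊕v w)  ≈⟨ L≈.⊕-cong z≈wz L≈.≈-refl ⟩
        wz ⊕v (wz ⊕v w) ≡⟨ ⊕-cancelˡ wz w ⟩
        w               ∎
        where open L≈.≈-Reasoning

    A+A⇒UnionSum : ∀ {h w} → ¬ W h → h ≈L w → SumSet A A h → UnionSum L w h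
    A+A⇒UnionSum {h} {w} h∉W h≈w (a , a′ , Aa@(_ , _ , αa , _) , Aa′ , _ , h≡a+a′)
      with u , u∈W , a≈u ← K_A⊆L+W αa =
      u , u∈W , a , a′ , (Aa , A⇒KA∖F Aa , a≈u) , (Aa′ , A⇒KA∖F Aa′ , a′≈u+w) ,
      h∉W ∘ subst W (sym h≡a+a′) , subst (λ v → W (v ⊕v h)) h≡a+a′ W≈.≈-refl
      where
      a′≈u+w : a′ ≈L u ⊕v w
      a′≈u+w = begin
        a′              ≡⟨ ⊕-cancelˡ a a′ ⟨
        a ⊕v (a ⊕v a′)  ≡⟨ cong (a ⊕v_) h≡a+a′ ⟨
        a ⊕v h          ≈⟨ L≈.⊕-cong a≈u h≈w ⟩
        u ⊕v w          ∎
        where open L≈.≈-Reasoning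

    UnionSum⇒A+A : ∀ {w z} → z ≈L w → UnionSum L w z → SumSet A A z
    UnionSum⇒A+A {w} {z} z≈w (u , _ , x , y , (Ax , _ , x≈u) , (Ay , _ , y≈u+w) , x+y∉W , x+y≈z) =
      x , y , Ax , Ay , x+y∉W ∘ (λ x≡y → subst (λ v → W (x ⊕v v)) x≡y W≈.≈-refl) , sym x+y≡z
      where
      x+y≈Lz : x ⊕v y ≈L z
      x+y≈Lz = begin
        x ⊕v y          ≈⟨ L≈.⊕-cong x≈u y≈u+w ⟩
        u ⊕v (u ⊕v w)   ≡⟨ ⊕-cancelˡ u w ⟩
        w               ≈⟨ L≈.≈-sym z≈w ⟩
        z               ∎
        where open L≈.≈-Reasoning
      x+y≡z : x ⊕v y ≡ z
      x+y≡z = ⊕≡0⇒≡ (L∩F̃≡0 x+y≈Lz (W⇒SpanC x+y≈z))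

    UnionSum-resp-≈W : ∀ {w z z′} → z ≈W z′ → UnionSum L w z → UnionSum L w z′
    UnionSum-resp-≈W z≈z′ (u , u∈W , x , y , Ax , Ay , x+y∉W , x+y≈z) =
      u , u∈W , x , y , Ax , Ay , x+y∉W , W≈.≈-trans x+y≈z z≈z′

    UnionSum⇒HinfBar : ∀ {w z} → ¬ W z → UnionSum L w z → HinfBar z
    UnionSum⇒HinfBar {z = z} z∉W
      (_ , _ , x , y , ((_ , _ , αx , βx) , _) , ((_ , _ , αy , βy) , _) , _ , x+y≈z) =
      z , ((z∉W ∘ inj₂ , αz , βz) , z∉W ∘ inj₁) , W≈.≈-refl
      where
      αz : α · z ≡ false
      αz = trans (sym (W≈.·-cong α W⇒α≡false x+y≈z)) (·-linear α αx αy)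
      βz : β · z ≡ false
      βz = trans (sym (W≈.·-cong β W⇒β≡false x+y≈z)) (·-linear β βx βy)

    HinfBar⇒H∞∖F : ∀ {z} → ¬ W z → HinfBar z → Hinf z × ¬ F z
    HinfBar⇒H∞∖F z∉W (h , ((_ , αh , βh) , _) , h≈z) =
      (z∉W ∘ inj₂ , trans (sym (W≈.·-cong α W⇒α≡false h≈z)) αh , trans (sym (W≈.·-cong β W⇒β≡false h≈z)) βh) ,
      z∉W ∘ inj₁

    RHS : Set
    RHS = ∀ w → W w → ∀ z → ¬ W z → (UnionSum L w z ⇔ HinfBar z)

    A+A⇒RHS : H∞∖F⊆A+A → RHS
    A+A⇒RHS A+A w w∈W z z∉W = mk⇔ (UnionSum⇒HinfBar z∉W) HinfBar⇒UnionSum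
      where
      HinfBar⇒UnionSum : HinfBar z → UnionSum L w z
      HinfBar⇒UnionSum z̄∈H̄∞
        with (_ , αz , βz) , _ ← HinfBar⇒H∞∖F z∉W z̄∈H̄∞
        with h , h≈z , h≈w ← coset-meets-L-translate αz w∈W
        = UnionSum-resp-≈W h≈z (A+A⇒UnionSum h∉W h≈w (A+A h∈H∞ (h∉W ∘ inj₁)))
        where
        h∉W : ¬ W h
        h∉W h∈W = z∉W (Equivalence.to W≈.≈0v⇔ (W≈.≈-trans (W≈.≈-sym h≈z) (Equivalence.from W≈.≈0v⇔ h∈W)))
        h∈H∞ : Hinf h
        h∈H∞ = h∉W ∘ inj₂ , trans (W≈.·-cong α W⇒α≡false h≈z) αz , trans (W≈.·-cong β W⇒β≡false h≈z) βz

    RHS⇒A+A : RHS → H∞∖F⊆A+A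
    RHS⇒A+A rhs {h} h∈H∞@(h≢0 , αh , _) h∉F with wh , wh∈W , h≈wh ← K_A⊆L+W αh =
      UnionSum⇒A+A h≈wh (Equivalence.from (rhs wh wh∈W h h∉W) (h , (h∈H∞ , h∉F) , W≈.≈-refl))
      where
      h∉W : ¬ W h
      h∉W (inj₁ h∈F) = h∉F h∈F
      h∉W (inj₂ h≡0) = h≢0 h≡0

proposition5p3 : (n : ℕ) (α β : V n) (S : V n → Bool) →
    let open Setting n α β S in
    IsCap S →
    α ≢ 0v → β ≢ 0v → α ≢ β →
    (∀ x → x ∈ S → ¬ Hinf x) →
    (∃ λ c → C c) →
    (r : ℕ) → 2 ≤ r → HasDim SpanC (suc r) →
    (c₀ : V n) → (∀ x → (Chat x × ¬ C x) ⇔ (x ≡ c₀)) →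
    (∀ a → HA a →
      (∀ z → SumSet (Acls a) C z ⇔ B'cls c₀ a z)
      × (∀ z → SumSet (Bcls c₀ a) C z ⇔ A'cls a z)) →
    (∀ a → HA a → IsSingleton (Acls a) × IsSingleton (Bcls c₀ a)) →
    (L : V n → Bool) → IsSubspace L → HasDim (λ x → x ∈ L) (n ∸ r) →
    (∀ x → x ∈ L → α · x ≡ false) →
    (∀ x → x ∈ L → ¬ F x) →
    IsCompleteCap S ⇔
      (∀ w → W w → ∀ z → ¬ W z → (UnionSum L w z ⇔ HinfBar z))
proposition5p3 n α β S S-cap _ β≢0 α≢β S∩H∞≡∅ C≢∅ r 2≤r dim-F̃ c₀ Ĉ∖C≡c₀ class-sums class-sizes
               L L-subspace dim-L L⊆K_A L∩F≡∅ =
  mk⇔ (λ complete → A+A⇒RHS (complete⇒A+A complete))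
      (λ rhs → secant⇒complete S-cap (A+A⇒secant (RHS⇒A+A rhs)))
  where
  open Geometry n α β S
  open Hypotheses S-cap β≢0 α≢β S∩H∞≡∅ C≢∅ r 2≤r dim-F̃ c₀ Ĉ∖C≡c₀ class-sums (λ a → proj₁ ∘ class-sizes a)
                  L L-subspace dim-L L⊆K_A L∩F≡∅
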